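{- Let $r,n\ge 1$ be integers and $c,d\in\mathbb{Z}$. Let $B_{c,d}$ be the $r\times r$ integer matrix with all diagonal entries $c$ and all off-diagonal entries $d$, and let $S_{cochar}(c,d,r,n)$ be the number of $\boldsymbol{x}\in(\mathbb{Z}/n\mathbb{Z})^r$ with $B_{c,d}\boldsymbol{x}\equiv\boldsymbol{0}\pmod n$. Put $\mathscr{d}_1=\gcd(c-d,n)$ and $\mathscr{d}_2=\gcd(c+(r-1)d,n)$. Then \[S_{cochar}(c,d,r,n)=\mathscr{d}_1^{\,r-1}\gcd\left(\mathscr{d}_2,\frac{dn}{\mathscr{d}_1}\right).\]
   Context: Equivalently, $S_{cochar}(c,d,r,n)=|\Lambda_{fin}|$ where $\Lambda_{fin}=\{\boldsymbol{x}\in(\mathbb{Z}/n\mathbb{Z})^r:\boldsymbol{x}^TB_{c,d}\boldsymbol{y}\equiv 0\pmod n\ \forall \boldsymbol{y}\in(\mathbb{Z}/n\mathbb{Z})^r\}$. -}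

module Defs where

open import Data.Nat as ℕ using (ℕ; zero; suc)
open import Data.Nat.DivMod as ℕD using ()
open import Data.Integer as ℤ using (ℤ; +_; _+_; _-_; _*_)
open import Data.Integer.Divisibility as ℤD using ()
open import Data.Integer.GCD as ℤG using ()
import Data.Nat.Divisibility as ND
import Data.Nat.GCD as ℕG
open import Data.Fin as Fin using (Fin; toℕ)
open import Data.Fin.Properties using (all?)
open import Data.List using (List; []; _∷_; map; concatMap; filter; length)
open import Data.Vec.Functional as VF using (Vector)
open import Relation.Nullary using (Dec; yes; no)
open import Relation.Nullary.Decidable using (⌊_⌋)
open import Data.Bool using (if_then_else_)

B : (c d : ℤ) (r : ℕ) → Fin r → Fin r → ℤ
B c d r i j = if ⌊ i Fin.≟ j ⌋ then c else d

sumℤ : (r : ℕ) → (Fin r → ℤ) → ℤ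
sumℤ zero    f = + 0
sumℤ (suc r) f = f Fin.zero + sumℤ r (λ j → f (Fin.suc j))

-- Elements of ℤ/nℤ are represented by Fin n (canonical residues 0,…,n-1).
-- The i-th entry of B_{c,d} x, computed in ℤ from the residues.
Bx : (c d : ℤ) (r n : ℕ) → Vector (Fin n) r → Fin r → ℤ
Bx c d r n x i = sumℤ r (λ j → B c d r i j * + toℕ (x j))

IsKernel : (c d : ℤ) (r n : ℕ) → Vector (Fin n) r → Set
IsKernel c d r n x = ∀ i → (+ n) ℤD.∣ Bx c d r n x i

isKernel? : (c d : ℤ) (r n : ℕ) (x : Vector (Fin n) r) → Dec (IsKernel c d r n x)
isKernel? c d r n x = all? (λ i → n ND.∣? ℤ.∣ Bx c d r n x i ∣)

allVecs : (r n : ℕ) → List (Vector (Fin n) r)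
allVecs zero    n = VF.[] ∷ []
allVecs (suc r) n = concatMap (λ a → map (a VF.∷_) (allVecs r n)) (Data.List.allFin n)
  where import Data.List

Scochar : (c d : ℤ) (r n : ℕ) → ℕ
Scochar c d r n = length (filter (isKernel? c d r n) (allVecs r n))

-- Natural-number quotient m / k, with the (irrelevant here) convention m / 0 = 0.
quot : ℕ → ℕ → ℕ
quot m zero    = 0
quot m (suc k) = m ℕD./ suc k

𝒹₁ : (c d : ℤ) (n : ℕ) → ℕ
𝒹₁ c d n = ℕG.gcd ℤ.∣ c - d ∣ n

𝒹₂ : (c d : ℤ) (r n : ℕ) → ℕ
𝒹₂ c d r n = ℕG.gcd ℤ.∣ c + (+ (r ℕ.∸ 1)) * d ∣ n

-- Right-hand side:  𝒹₁^(r-1) · gcd(𝒹₂, d n / 𝒹₁).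
-- Since 𝒹₁ ∣ n, d n / 𝒹₁ = d · (n / 𝒹₁); gcd ignores signs.
rhs : (c d : ℤ) (r n : ℕ) → ℕ
rhs c d r n = (𝒹₁ c d n ℕ.^ (r ℕ.∸ 1)) ℕ.* ℕG.gcd (𝒹₂ c d r n) (ℤ.∣ d ∣ ℕ.* quot n (𝒹₁ c d n))

-- Put a = c − d, g = gcd(a, n) = 𝒹₁, m = n / g and f = d m. Row i of B x is a xᵢ + d Σx, and n ∣ a z
-- iff m ∣ z, so x lies in the kernel iff all xᵢ lie in one class ρ mod m and n ∣ a ρ + d Σx. Writing
-- xᵢ = ρ + m tᵢ with tᵢ < g, and using n ∣ a m and n ∣ f g, the condition only sees Σtᵢ mod g; summing
-- out r − 1 of the tᵢ leaves g^(r−1) N(e), where e = c + (r − 1) d and N(e) counts the (ρ, t) < (m, g)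
-- with n ∣ e ρ + f t. The pairs (x, y) < (n, n) with n ∣ e x + f y number n N(e) (summing over y
-- first, with period g) and also n gcd(f, gcd(e, n)) (summing over x first, by
-- #{x < n : n ∣ e x + b} = gcd(e, n) [gcd(e, n) ∣ b]), whence N(e) = gcd(𝒹₂, d n / 𝒹₁).

module Submission where

open import Defs
open import Data.Nat using (ℕ; _≥_)
open import Data.Integer using (ℤ)
open import Relation.Binary.PropositionalEquality using (_≡_)

open import Data.Product using (_×_; _,_; ∃)
open import Data.Bool using (true; false; if_then_else_)
open import Data.Empty using (⊥-elim)
open import Data.Fin as Fin using (Fin; toℕ)
open import Data.Fin.Properties using (all?)
open import Data.List as List using (List; filter; length)
import Data.List.Properties as List
open import Data.Vec.Functional using (Vector; _∷_)
open import Function using (_∘_; id)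
open import Relation.Nullary using (Dec; yes; no; does; ¬_)
open import Relation.Nullary.Decidable using (_×-dec_)
open import Relation.Binary.PropositionalEquality
  using (_≢_; refl; sym; trans; cong; cong₂; subst; subst₂; module ≡-Reasoning)

module FiniteSums where

  open import Data.Nat using (zero; suc; _+_; _*_; _<_; z≤n; s≤s; NonZero; _≟_)
  open import Data.Nat.DivMod using (_%_; %-remove-+ˡ; m<n⇒m%n≡m)
  open import Data.Nat.Divisibility using (m∣m*n)
  open import Data.Nat.Properties
  open import Algebra.Properties.CommutativeSemigroup +-commutativeSemigroup using (interchange)

  𝟙 : ∀ {p} {P : Set p} → Dec P → ℕ
  𝟙 P? = if does P? then 1 else 0

  module _ {p q} {P : Set p} {Q : Set q} where

    𝟙-cong : (P? : Dec P) (Q? : Dec Q) → (P → Q) → (Q → P) → 𝟙 P? ≡ 𝟙 Q?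
    𝟙-cong (yes _) (yes _) _   _   = refl
    𝟙-cong (yes p) (no ¬q) p→q _   = ⊥-elim (¬q (p→q p))
    𝟙-cong (no ¬p) (yes q) _   q→p = ⊥-elim (¬p (q→p q))
    𝟙-cong (no _)  (no _)  _   _   = refl

    𝟙-× : (P? : Dec P) (Q? : Dec Q) → 𝟙 (P? ×-dec Q?) ≡ 𝟙 P? * 𝟙 Q?
    𝟙-× (yes _) (yes _) = refl
    𝟙-× (yes _) (no _)  = refl
    𝟙-× (no _)  (yes _) = refl
    𝟙-× (no _)  (no _)  = refl

  module _ {p} {P : Set p} where

    𝟙-yes : (P? : Dec P) → P → 𝟙 P? ≡ 1
    𝟙-yes (yes _) _ = refl
    𝟙-yes (no ¬p) p = ⊥-elim (¬p p)

    𝟙-no : (P? : Dec P) → ¬ P → 𝟙 P? ≡ 0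
    𝟙-no (yes p) ¬p = ⊥-elim (¬p p)
    𝟙-no (no _)  _  = refl

  ∑< : ℕ → (ℕ → ℕ) → ℕ
  ∑< zero    f = 0
  ∑< (suc k) f = f 0 + ∑< k (f ∘ suc)

  syntax ∑< k (λ i → e) = ∑[ i < k ] e

  Periodic : ℕ → (ℕ → ℕ) → Set
  Periodic p f = ∀ x → f (x + p) ≡ f x

  ∑-cong-< : ∀ k {f g : ℕ → ℕ} → (∀ i → i < k → f i ≡ g i) → ∑< k f ≡ ∑< k g
  ∑-cong-< zero    eq = refl
  ∑-cong-< (suc k) eq = cong₂ _+_ (eq 0 (s≤s z≤n)) (∑-cong-< k (λ i i<k → eq (suc i) (s≤s i<k)))

  ∑-cong : ∀ k {f g : ℕ → ℕ} → (∀ i → f i ≡ g i) → ∑< k f ≡ ∑< k g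
  ∑-cong k eq = ∑-cong-< k (λ i _ → eq i)

  ∑-const : ∀ k c → ∑[ _ < k ] c ≡ k * c
  ∑-const zero    c = refl
  ∑-const (suc k) c = cong (c +_) (∑-const k c)

  ∑-zero : ∀ k {f : ℕ → ℕ} → (∀ i → i < k → f i ≡ 0) → ∑< k f ≡ 0
  ∑-zero k eq = trans (∑-cong-< k eq) (trans (∑-const k 0) (*-zeroʳ k))

  ∑-distrib-+ : ∀ k (f g : ℕ → ℕ) → ∑[ i < k ] (f i + g i) ≡ ∑< k f + ∑< k g
  ∑-distrib-+ zero    f g = refl
  ∑-distrib-+ (suc k) f g = trans (cong (f 0 + g 0 +_) (∑-distrib-+ k (f ∘ suc) (g ∘ suc)))
                                  (interchange (f 0) (g 0) _ _)

  ∑-distribˡ-* : ∀ k c (f : ℕ → ℕ) → ∑[ i < k ] (c * f i) ≡ c * ∑< k f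
  ∑-distribˡ-* zero    c f = sym (*-zeroʳ c)
  ∑-distribˡ-* (suc k) c f = trans (cong (c * f 0 +_) (∑-distribˡ-* k c (f ∘ suc)))
                                   (sym (*-distribˡ-+ c (f 0) _))

  ∑-swap : ∀ a b (f : ℕ → ℕ → ℕ) → ∑[ i < a ] ∑[ j < b ] f i j ≡ ∑[ j < b ] ∑[ i < a ] f i j
  ∑-swap zero    b f = sym (∑-zero b (λ _ _ → refl))
  ∑-swap (suc a) b f = trans (cong (∑< b (f 0) +_) (∑-swap a b (f ∘ suc)))
                             (sym (∑-distrib-+ b (f 0) (λ j → ∑[ i < a ] f (suc i) j)))

  ∑-++ : ∀ a b (f : ℕ → ℕ) → ∑< (a + b) f ≡ ∑< a f + ∑[ i < b ] f (a + i)
  ∑-++ zero    b f = refl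
  ∑-++ (suc a) b f = trans (cong (f 0 +_) (∑-++ a b (f ∘ suc))) (sym (+-assoc (f 0) _ _))

  ∑-blocks : ∀ g m (f : ℕ → ℕ) → ∑< (g * m) f ≡ ∑[ t < g ] ∑[ j < m ] f (m * t + j)
  ∑-blocks zero    m f = refl
  ∑-blocks (suc g) m f = begin
    ∑< (m + g * m) f
      ≡⟨ ∑-++ m (g * m) f ⟩
    ∑< m f + ∑[ i < g * m ] f (m + i)
      ≡⟨ cong₂ _+_ (∑-cong m first) (∑-blocks g m (λ i → f (m + i))) ⟩
    ∑[ j < m ] f (m * 0 + j) + ∑[ t < g ] ∑[ j < m ] f (m + (m * t + j))
      ≡⟨ cong (_ +_) (∑-cong g (λ t → ∑-cong m (λ j → cong f (next t j)))) ⟩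
    ∑[ j < m ] f (m * 0 + j) + ∑[ t < g ] ∑[ j < m ] f (m * suc t + j)
      ∎
    where
    open ≡-Reasoning
    first : ∀ j → f j ≡ f (m * 0 + j)
    first j = cong (λ z → f (z + j)) (sym (*-zeroʳ m))
    next : ∀ t j → m + (m * t + j) ≡ m * suc t + j
    next t j = trans (sym (+-assoc m (m * t) j)) (cong (_+ j) (sym (*-suc m t)))

  ∑-shift : ∀ p {f : ℕ → ℕ} → Periodic p f → ∀ s → ∑[ i < p ] f (s + i) ≡ ∑< p f
  ∑-shift p     per zero    = refl
  ∑-shift p {f} per (suc s) = +-cancelˡ-≡ (f s) _ _ (begin
    f s + ∑[ i < p ] f (suc s + i)
      ≡⟨ cong₂ _+_ (cong f (sym (+-identityʳ s))) (∑-cong p (λ i → cong f (sym (+-suc s i)))) ⟩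
    ∑[ i < suc p ] f (s + i)
      ≡⟨ cong (λ k → ∑[ i < k ] f (s + i)) (+-comm 1 p) ⟩
    ∑[ i < p + 1 ] f (s + i)
      ≡⟨ ∑-++ p 1 (λ i → f (s + i)) ⟩
    ∑[ i < p ] f (s + i) + (f (s + (p + 0)) + 0)
      ≡⟨ cong₂ _+_ (∑-shift p per s) wrap-around ⟩
    ∑< p f + f s
      ≡⟨ +-comm _ (f s) ⟩
    f s + ∑< p f
      ∎)
    where
    open ≡-Reasoning
    wrap-around : f (s + (p + 0)) + 0 ≡ f s
    wrap-around = trans (+-identityʳ _) (trans (cong (λ x → f (s + x)) (+-identityʳ p)) (per s))

  Periodic-* : ∀ p {f : ℕ → ℕ} → Periodic p f → ∀ t j → f (p * t + j) ≡ f j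
  Periodic-* p {f} per zero    j = cong (λ z → f (z + j)) (*-zeroʳ p)
  Periodic-* p {f} per (suc t) j = begin
    f (p * suc t + j)    ≡⟨ cong (λ x → f (x + j)) (trans (*-suc p t) (+-comm p (p * t))) ⟩
    f (p * t + p + j)    ≡⟨ cong f (+-assoc (p * t) p j) ⟩
    f (p * t + (p + j))  ≡⟨ cong (λ x → f (p * t + x)) (+-comm p j) ⟩
    f (p * t + (j + p))  ≡⟨ cong f (sym (+-assoc (p * t) j p)) ⟩
    f (p * t + j + p)    ≡⟨ per _ ⟩
    f (p * t + j)        ≡⟨ Periodic-* p per t j ⟩
    f j                  ∎
    where open ≡-Reasoning

  ∑-periodic : ∀ q p {f : ℕ → ℕ} → Periodic p f → ∑< (q * p) f ≡ q * ∑< p f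
  ∑-periodic q p {f} per = begin
    ∑< (q * p) f                       ≡⟨ ∑-blocks q p f ⟩
    ∑[ t < q ] ∑[ j < p ] f (p * t + j) ≡⟨ ∑-cong q (λ t → ∑-cong p (Periodic-* p per t)) ⟩
    ∑[ t < q ] ∑< p f                   ≡⟨ ∑-const q _ ⟩
    q * ∑< p f                          ∎
    where open ≡-Reasoning

  ∑-delta : ∀ m t (f : ℕ → ℕ) → t < m → (∀ j → j < m → j ≢ t → f j ≡ 0) → ∑< m f ≡ f t
  ∑-delta (suc m) zero    f _         off =
    trans (cong (f 0 +_) (∑-zero m (λ i i<m → off (suc i) (s≤s i<m) λ ()))) (+-identityʳ _)
  ∑-delta (suc m) (suc t) f (s≤s t<m) off =
    trans (cong (_+ ∑< m (f ∘ suc)) (off 0 (s≤s z≤n) λ ()))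
          (∑-delta m t (f ∘ suc) t<m (λ j j<m j≢t → off (suc j) (s≤s j<m) (j≢t ∘ suc-injective)))

  [m*t+j]%m≡j : ∀ m t {j} .{{_ : NonZero m}} → j < m → (m * t + j) % m ≡ j
  [m*t+j]%m≡j m t {j} j<m = trans (%-remove-+ˡ j (m∣m*n t)) (m<n⇒m%n≡m j<m)

  ∑-residue-class : ∀ g m ρ (F : ℕ → ℕ) .{{_ : NonZero m}} → ρ < m →
                    ∑[ y < g * m ] (𝟙 (y % m ≟ ρ) * F y) ≡ ∑[ t < g ] F (m * t + ρ)
  ∑-residue-class g m ρ F ρ<m = trans (∑-blocks g m _) (∑-cong g λ t →
    trans (∑-delta m ρ _ ρ<m (other-residues t)) (only-ρ t))
    where
    other-residues : ∀ t j → j < m → j ≢ ρ → 𝟙 ((m * t + j) % m ≟ ρ) * F (m * t + j) ≡ 0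
    other-residues t j j<m j≢ρ =
      cong (_* F (m * t + j)) (𝟙-no (_ ≟ ρ) (j≢ρ ∘ trans (sym ([m*t+j]%m≡j m t j<m))))
    only-ρ : ∀ t → 𝟙 ((m * t + ρ) % m ≟ ρ) * F (m * t + ρ) ≡ F (m * t + ρ)
    only-ρ t = trans (cong (_* F (m * t + ρ)) (𝟙-yes (_ ≟ ρ) ([m*t+j]%m≡j m t ρ<m))) (+-identityʳ _)

  ∑ⱽ : (n r : ℕ) → ((Fin r → ℕ) → ℕ) → ℕ
  ∑ⱽ n zero    F = F (λ ())
  ∑ⱽ n (suc r) F = ∑[ a < n ] ∑ⱽ n r (λ v → F (a ∷ v))

  Extensional : ∀ {r} → ((Fin r → ℕ) → ℕ) → Set
  Extensional F = ∀ {v w} → (∀ i → v i ≡ w i) → F v ≡ F w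

  ∑ⱽ-cong : ∀ n r {F G : (Fin r → ℕ) → ℕ} → (∀ v → F v ≡ G v) → ∑ⱽ n r F ≡ ∑ⱽ n r G
  ∑ⱽ-cong n zero    eq = eq _
  ∑ⱽ-cong n (suc r) eq = ∑-cong n (λ a → ∑ⱽ-cong n r (λ v → eq (a ∷ v)))

  ∑ⱽ-distribˡ-* : ∀ n r c (F : (Fin r → ℕ) → ℕ) → ∑ⱽ n r (λ v → c * F v) ≡ c * ∑ⱽ n r F
  ∑ⱽ-distribˡ-* n zero    c F = refl
  ∑ⱽ-distribˡ-* n (suc r) c F = trans (∑-cong n (λ a → ∑ⱽ-distribˡ-* n r c _)) (∑-distribˡ-* n c _)

  ∑ⱽ-∑-swap : ∀ n r m (F : (Fin r → ℕ) → ℕ → ℕ) →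
              ∑ⱽ n r (λ v → ∑[ ρ < m ] F v ρ) ≡ ∑[ ρ < m ] ∑ⱽ n r (λ v → F v ρ)
  ∑ⱽ-∑-swap n zero    m F = refl
  ∑ⱽ-∑-swap n (suc r) m F = trans (∑-cong n (λ a → ∑ⱽ-∑-swap n r m (λ v → F (a ∷ v))))
                                  (∑-swap n m _)

  module _ {A : Set} {P : A → Set} (P? : ∀ x → Dec (P x)) where

    length-filter-∷ : ∀ x xs → length (filter P? (x List.∷ xs)) ≡ 𝟙 (P? x) + length (filter P? xs)
    length-filter-∷ x xs with does (P? x)
    ... | true  = refl
    ... | false = refl

    length-filter-++ : ∀ xs ys →
      length (filter P? (xs List.++ ys)) ≡ length (filter P? xs) + length (filter P? ys)
    length-filter-++ xs ys = trans (cong length (List.filter-++ P? xs ys)) (List.length-++ (filter P? xs))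

    length-filter-concatMap : ∀ {B : Set} k (g : Fin k → B) (h : B → List A) (ψ : ℕ → ℕ) →
      (∀ i → length (filter P? (h (g i))) ≡ ψ (toℕ i)) →
      length (filter P? (List.concatMap h (List.tabulate g))) ≡ ∑< k ψ
    length-filter-concatMap zero    g h ψ eq = refl
    length-filter-concatMap (suc k) g h ψ eq = trans (length-filter-++ (h (g Fin.zero)) _)
      (cong₂ _+_ (eq Fin.zero) (length-filter-concatMap k (g ∘ Fin.suc) h (ψ ∘ suc) (eq ∘ Fin.suc)))

  length-filter-map : ∀ {A B : Set} {P : A → Set} (P? : ∀ x → Dec (P x)) (h : B → A) xs →
    length (filter P? (List.map h xs)) ≡ length (filter (P? ∘ h) xs)
  length-filter-map P? h List.[]       = refl
  length-filter-map P? h (x List.∷ xs) = begin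
    length (filter P? (h x List.∷ List.map h xs))     ≡⟨ length-filter-∷ P? (h x) _ ⟩
    𝟙 (P? (h x)) + length (filter P? (List.map h xs)) ≡⟨ cong (𝟙 (P? (h x)) +_) (length-filter-map P? h xs) ⟩
    𝟙 (P? (h x)) + length (filter (P? ∘ h) xs)        ≡⟨ length-filter-∷ (P? ∘ h) x xs ⟨
    length (filter (P? ∘ h) (x List.∷ xs))            ∎
    where open ≡-Reasoning

  length-filter-allVecs : ∀ n r {P : Vector (Fin n) r → Set} (P? : ∀ x → Dec (P x))
    (F : (Fin r → ℕ) → ℕ) → Extensional F → (∀ x → 𝟙 (P? x) ≡ F (toℕ ∘ x)) →
    length (filter P? (allVecs r n)) ≡ ∑ⱽ n r F
  length-filter-allVecs n zero    P? F F-ext eq =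
    trans (length-filter-∷ P? _ List.[]) (trans (+-identityʳ _) (trans (eq _) (F-ext λ ())))
  length-filter-allVecs n (suc r) P? F F-ext eq =
    length-filter-concatMap P? n id (λ a → List.map (a ∷_) (allVecs r n)) _ λ a →
      trans (length-filter-map P? (a ∷_) (allVecs r n))
            (length-filter-allVecs n r (P? ∘ (a ∷_)) (λ v → F (toℕ a ∷ v))
              (λ v≗w → F-ext λ { Fin.zero → refl ; (Fin.suc i) → v≗w i })
              (λ x → trans (eq (a ∷ x)) (F-ext λ { Fin.zero → refl ; (Fin.suc i) → refl })))

open FiniteSums

open import Data.Nat as ℕ using (zero; suc; _<_; NonZero)
import Data.Nat.Properties as ℕ
import Data.Nat.Divisibility as ℕ
import Data.Nat.DivMod as ℕ
open import Data.Nat.GCD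
  using (gcd; gcd[m,n]∣m; gcd[m,n]∣n; gcd-GCD; gcd-comm; gcd[m,n]≡0⇒n≡0; module Bézout)
open import Data.Nat.Coprimality as Coprime using (Coprime; coprime-/gcd; coprime-divisor)
open import Data.Integer using (+_; -_; -[1+_]; _+_; _-_; _*_; ∣_∣)
import Data.Integer.Properties as ℤ
open import Data.Integer.Divisibility.Signed
  using ( _∣_; divides; ∣ᵤ⇒∣; ∣⇒∣ᵤ; ∣m∣n⇒∣m+n; ∣m∣n⇒∣m-n; ∣m+n∣n⇒∣m; ∣m+n∣m⇒∣n
        ; ∣n⇒∣m*n; ∣m⇒∣m*n; ∣-refl; ∣-trans)
open import Data.Integer.DivMod using (_%ℕ_; _/ℕ_; a≡a%ℕn+[a/ℕn]*n)
open import Data.Integer.Tactic.RingSolver using (solve-∀)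
open import Function.Bundles using (_⇔_; mk⇔; Equivalence)

𝟙∣ : ℕ → ℤ → ℕ
𝟙∣ K X = 𝟙 (K ℕ.∣? ∣ X ∣)

syntax 𝟙∣ K X = 𝟙[ K ∣ X ]

𝟙∣-cong : ∀ K X Y → ((+ K) ∣ X → (+ K) ∣ Y) → ((+ K) ∣ Y → (+ K) ∣ X) →
          𝟙[ K ∣ X ] ≡ 𝟙[ K ∣ Y ]
𝟙∣-cong K X Y X→Y Y→X = 𝟙-cong (K ℕ.∣? ∣ X ∣) (K ℕ.∣? ∣ Y ∣)
  (λ K∣X → ∣⇒∣ᵤ (X→Y (∣ᵤ⇒∣ {+ K} {X} K∣X))) (λ K∣Y → ∣⇒∣ᵤ (Y→X (∣ᵤ⇒∣ {+ K} {Y} K∣Y)))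

𝟙∣-+ : ∀ K X {W} → (+ K) ∣ W → 𝟙[ K ∣ X + W ] ≡ 𝟙[ K ∣ X ]
𝟙∣-+ K X {W} K∣W =
  𝟙∣-cong K (X + W) X (λ K∣X+W → ∣m+n∣n⇒∣m K∣X+W K∣W) (λ K∣X → ∣m∣n⇒∣m+n K∣X K∣W)

𝟙∣-no : ∀ K X → ¬ (+ K) ∣ X → 𝟙[ K ∣ X ] ≡ 0
𝟙∣-no K X K∤X = 𝟙-no (K ℕ.∣? ∣ X ∣) (K∤X ∘ ∣ᵤ⇒∣ {+ K} {X})

quot-* : ∀ K h → h ℕ.∣ K → quot K h ℕ.* h ≡ K
quot-* K zero    h∣K = sym (ℕ.0∣⇒≡0 h∣K)
quot-* K (suc h) h∣K = ℕ.m/n*n≡m h∣K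

gcd-nonZero : ∀ E K .{{_ : NonZero K}} → NonZero (gcd E K)
gcd-nonZero E K = ℕ.≢-nonZero (ℕ.≢-nonZero⁻¹ K ∘ gcd[m,n]≡0⇒n≡0 E)

coprime-quot-gcd : ∀ E K .{{_ : NonZero K}} → Coprime (quot K (gcd E K)) (quot E (gcd E K))
coprime-quot-gcd E K with gcd E K | gcd-nonZero E K | coprime-/gcd E K
... | suc h | _ | coprime = Coprime.sym coprime

gcdᶻ : ℤ → ℕ → ℕ
gcdᶻ E K = gcd ∣ E ∣ K

∣*⇔quot-gcd∣ : ∀ E K z .{{_ : NonZero K}} → K ℕ.∣ E ℕ.* z ⇔ quot K (gcd E K) ℕ.∣ z
∣*⇔quot-gcd∣ E K z = mk⇔ to from
  where
  h = gcd E K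
  q = quot K h
  e = quot E h
  instance
    h≢0 : NonZero h
    h≢0 = gcd-nonZero E K
  qh≡K : q ℕ.* h ≡ K
  qh≡K = quot-* K h (gcd[m,n]∣n E K)
  ezh≡Ez : e ℕ.* z ℕ.* h ≡ E ℕ.* z
  ezh≡Ez = begin
    e ℕ.* z ℕ.* h    ≡⟨ ℕ.*-assoc e z h ⟩
    e ℕ.* (z ℕ.* h)  ≡⟨ cong (e ℕ.*_) (ℕ.*-comm z h) ⟩
    e ℕ.* (h ℕ.* z)  ≡⟨ ℕ.*-assoc e h z ⟨
    e ℕ.* h ℕ.* z    ≡⟨ cong (ℕ._* z) (quot-* E h (gcd[m,n]∣m E K)) ⟩
    E ℕ.* z          ∎
    where open ≡-Reasoning
  to : K ℕ.∣ E ℕ.* z → q ℕ.∣ z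
  to K∣Ez = coprime-divisor (coprime-quot-gcd E K)
    (ℕ.*-cancelʳ-∣ h (subst₂ ℕ._∣_ (sym qh≡K) (sym ezh≡Ez) K∣Ez))
  from : q ℕ.∣ z → K ℕ.∣ E ℕ.* z
  from q∣z = subst₂ ℕ._∣_ qh≡K ezh≡Ez (ℕ.*-monoˡ-∣ h (ℕ.∣n⇒∣m*n e q∣z))

∣*⇔quot-gcd∣ℤ : ∀ E K Z .{{_ : NonZero K}} → ((+ K) ∣ E * Z) ⇔ ((+ quot K (gcdᶻ E K)) ∣ Z)
∣*⇔quot-gcd∣ℤ E K Z = mk⇔
  (λ K∣EZ → ∣ᵤ⇒∣ (Equivalence.to   gauss (subst (K ℕ.∣_) (ℤ.abs-* E Z) (∣⇒∣ᵤ K∣EZ))))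
  (λ q∣Z  → ∣ᵤ⇒∣ (subst (K ℕ.∣_) (sym (ℤ.abs-* E Z)) (Equivalence.from gauss (∣⇒∣ᵤ q∣Z))))
  where gauss = ∣*⇔quot-gcd∣ (∣ E ∣) K (∣ Z ∣)

∑-multiples : ∀ h q .{{_ : NonZero q}} → ∑[ x < h ℕ.* q ] 𝟙 (q ℕ.∣? x) ≡ h
∑-multiples h q = begin
  ∑[ x < h ℕ.* q ] 𝟙 (q ℕ.∣? x)  ≡⟨ ∑-periodic h q periodic ⟩
  h ℕ.* ∑[ x < q ] 𝟙 (q ℕ.∣? x)  ≡⟨ cong (h ℕ.*_) one-per-period ⟩
  h ℕ.* 1                         ≡⟨ ℕ.*-identityʳ h ⟩
  h                               ∎
  where
  open ≡-Reasoning
  periodic : Periodic q (λ x → 𝟙 (q ℕ.∣? x))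
  periodic x = 𝟙-cong (q ℕ.∣? (x ℕ.+ q)) (q ℕ.∣? x)
    (λ q∣x+q → ℕ.∣m+n∣m⇒∣n (subst (q ℕ.∣_) (ℕ.+-comm x q) q∣x+q) ℕ.∣-refl)
    (λ q∣x → ℕ.∣m∣n⇒∣m+n q∣x ℕ.∣-refl)
  one-per-period : ∑[ x < q ] 𝟙 (q ℕ.∣? x) ≡ 1
  one-per-period = trans
    (∑-delta q 0 _ (ℕ.>-nonZero⁻¹ q) λ j j<q j≢0 →
      𝟙-no (q ℕ.∣? j) (ℕ.>⇒∤ {{ℕ.≢-nonZero j≢0}} j<q))
    (𝟙-yes (q ℕ.∣? 0) (q ℕ.∣0))

∑-𝟙∣-homogeneous : ∀ E K .{{_ : NonZero K}} → ∑[ x < K ] 𝟙[ K ∣ E * + x ] ≡ gcdᶻ E K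
∑-𝟙∣-homogeneous E K = begin
  ∑[ x < K ] 𝟙[ K ∣ E * + x ]    ≡⟨ ∑-cong K gauss ⟩
  ∑[ x < K ] 𝟙 (q ℕ.∣? x)        ≡⟨ cong (λ k → ∑[ x < k ] 𝟙 (q ℕ.∣? x)) K≡hq ⟩
  ∑[ x < h ℕ.* q ] 𝟙 (q ℕ.∣? x)  ≡⟨ ∑-multiples h q ⟩
  h                              ∎
  where
  open ≡-Reasoning
  h = gcdᶻ E K
  q = quot K h
  qh≡K : q ℕ.* h ≡ K
  qh≡K = quot-* K h (gcd[m,n]∣n (∣ E ∣) K)
  K≡hq : K ≡ h ℕ.* q
  K≡hq = trans (sym qh≡K) (ℕ.*-comm q h)
  instance
    q≢0 : NonZero q
    q≢0 = ℕ.≢-nonZero λ q≡0 → ℕ.≢-nonZero⁻¹ K (trans (sym qh≡K) (cong (ℕ._* h) q≡0))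
  gauss : ∀ x → 𝟙[ K ∣ E * + x ] ≡ 𝟙 (q ℕ.∣? x)
  gauss x = 𝟙-cong (K ℕ.∣? ∣ E * + x ∣) (q ℕ.∣? x)
    (Equivalence.to   (∣*⇔quot-gcd∣ (∣ E ∣) K x) ∘ subst (K ℕ.∣_) (ℤ.abs-* E (+ x)))
    (subst (K ℕ.∣_) (sym (ℤ.abs-* E (+ x))) ∘ Equivalence.from (∣*⇔quot-gcd∣ (∣ E ∣) K x))

bézout : ∀ E K → ∃ λ X → (+ K) ∣ E * X - + gcdᶻ E K
bézout (+ A)    K = bézoutℕ
  where
  h = gcd A K
  pos-+* : ∀ a b c → + (a ℕ.+ b ℕ.* c) ≡ + a + + b * + c
  pos-+* a b c = trans (ℤ.pos-+ a (b ℕ.* c)) (cong (_+_ (+ a)) (ℤ.pos-* b c))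
  bézoutℕ : ∃ λ X → (+ K) ∣ + A * X - + h
  bézoutℕ with Bézout.identity (gcd-GCD A K)
  ... | Bézout.+- x y h+yK≡xA = + x , divides (+ y) (begin
    + A * + x - + h          ≡⟨ cong (_- + h) (trans (ℤ.*-comm (+ A) (+ x)) (sym (ℤ.pos-* x A))) ⟩
    + (x ℕ.* A) - + h        ≡⟨ cong (λ z → + z - + h) h+yK≡xA ⟨
    + (h ℕ.+ y ℕ.* K) - + h  ≡⟨ cong (_- + h) (pos-+* h y K) ⟩
    + h + + y * + K - + h    ≡⟨ +-cancel (+ h) (+ y * + K) ⟩
    + y * + K                ∎)
    where
    open ≡-Reasoning
    +-cancel : ∀ a b → a + b - a ≡ b
    +-cancel = solve-∀
  ... | Bézout.-+ x y h+xA≡yK = - + x , divides (- + y) (begin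
    + A * - + x - + h        ≡⟨ rearrange (+ A) (+ x) (+ h) ⟩
    - (+ h + + x * + A)      ≡⟨ cong -_ (pos-+* h x A) ⟨
    - + (h ℕ.+ x ℕ.* A)      ≡⟨ cong (λ z → - + z) h+xA≡yK ⟩
    - + (y ℕ.* K)            ≡⟨ cong -_ (ℤ.pos-* y K) ⟩
    - (+ y * + K)            ≡⟨ ℤ.neg-distribˡ-* (+ y) (+ K) ⟩
    - + y * + K              ∎)
    where
    open ≡-Reasoning
    rearrange : ∀ a x h → a * - x - h ≡ - (h + x * a)
    rearrange = solve-∀
bézout -[1+ A ] K with bézout (+ suc A) K
... | X , K∣ = - X , subst (λ Y → (+ K) ∣ Y - + gcd (suc A) K) (neg*neg (+ suc A) X) K∣
  where
  neg*neg : ∀ a x → a * x ≡ - a * - x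
  neg*neg = solve-∀

solution-%ℕ : ∀ E b K Y .{{_ : NonZero K}} → (+ K) ∣ E * Y + b → (+ K) ∣ E * + (Y %ℕ K) + b
solution-%ℕ E b K Y K∣EY+b = subst ((+ K) ∣_) (drop-multiple E (+ (Y %ℕ K)) (Y /ℕ K) (+ K) b)
  (∣m∣n⇒∣m-n K∣Er+EqK+b (∣n⇒∣m*n (E * (Y /ℕ K)) ∣-refl))
  where
  K∣Er+EqK+b : (+ K) ∣ E * (+ (Y %ℕ K) + Y /ℕ K * + K) + b
  K∣Er+EqK+b = subst (λ Z → (+ K) ∣ E * Z + b) (a≡a%ℕn+[a/ℕn]*n Y K) K∣EY+b
  drop-multiple : ∀ e r q k b → e * (r + q * k) + b - e * q * k ≡ e * r + b
  drop-multiple = solve-∀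

solvable : ∀ E b K .{{_ : NonZero K}} → gcdᶻ E K ℕ.∣ ∣ b ∣ → ∃ λ x → (+ K) ∣ E * + x + b
solvable E b K h∣b with bézout E K | ∣ᵤ⇒∣ {+ gcdᶻ E K} {b} h∣b
... | X , K∣EX-h | divides β b≡βh = Y %ℕ K , solution-%ℕ E b K Y K∣EY+b
  where
  Y = X * - β
  scale : ∀ e x β h → (e * x - h) * - β ≡ e * (x * - β) + β * h
  scale = solve-∀
  K∣EY+b : (+ K) ∣ E * Y + b
  K∣EY+b = subst ((+ K) ∣_) (trans (scale E X β (+ gcdᶻ E K)) (cong (_+_ (E * Y)) (sym b≡βh)))
                 (∣m⇒∣m*n (- β) K∣EX-h)

∑-𝟙∣-linear : ∀ E b K .{{_ : NonZero K}} →
  ∑[ x < K ] 𝟙[ K ∣ E * + x + b ] ≡ gcdᶻ E K ℕ.* 𝟙[ gcdᶻ E K ∣ b ]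
∑-𝟙∣-linear E b K with gcdᶻ E K ℕ.∣? ∣ b ∣
... | no h∤b = begin
  ∑[ x < K ] 𝟙[ K ∣ E * + x + b ]  ≡⟨ ∑-zero K (λ x _ → 𝟙∣-no K (E * + x + b) (h∤b ∘ ∣⇒∣ᵤ ∘ h∣b x)) ⟩
  0                                ≡⟨ ℕ.*-zeroʳ h ⟨
  h ℕ.* 0                          ∎
  where
  open ≡-Reasoning
  h = gcdᶻ E K
  h∣b : ∀ x → (+ K) ∣ E * + x + b → (+ h) ∣ b
  h∣b x K∣Ex+b = ∣m+n∣m⇒∣n (∣-trans (∣ᵤ⇒∣ (gcd[m,n]∣n (∣ E ∣) K)) K∣Ex+b)
                            (∣m⇒∣m*n (+ x) (∣ᵤ⇒∣ {+ h} {E} (gcd[m,n]∣m (∣ E ∣) K)))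
... | yes h∣b with solvable E b K h∣b
... | s , K∣Es+b = begin
  ∑[ x < K ] f x                   ≡⟨ ∑-shift K periodic s ⟨
  ∑[ i < K ] f (s ℕ.+ i)           ≡⟨ ∑-cong K shifted ⟩
  ∑[ i < K ] 𝟙[ K ∣ E * + i ]      ≡⟨ ∑-𝟙∣-homogeneous E K ⟩
  h                                ≡⟨ ℕ.*-identityʳ h ⟨
  h ℕ.* 1                          ∎
  where
  open ≡-Reasoning
  h = gcdᶻ E K
  f : ℕ → ℕ
  f x = 𝟙[ K ∣ E * + x + b ]
  expandˡ : ∀ e x y b → e * (x + y) + b ≡ e * y + (e * x + b)
  expandˡ = solve-∀
  expandʳ : ∀ e x y b → e * (x + y) + b ≡ e * x + b + e * y
  expandʳ = solve-∀
  shifted : ∀ i → f (s ℕ.+ i) ≡ 𝟙[ K ∣ E * + i ]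
  shifted i = trans (cong (λ Z → 𝟙[ K ∣ E * Z + b ]) (ℤ.pos-+ s i))
                    (trans (cong (λ Z → 𝟙[ K ∣ Z ]) (expandˡ E (+ s) (+ i) b)) (𝟙∣-+ K (E * + i) K∣Es+b))
  periodic : Periodic K f
  periodic x = trans (cong (λ Z → 𝟙[ K ∣ E * Z + b ]) (ℤ.pos-+ x K))
                     (trans (cong (λ Z → 𝟙[ K ∣ Z ]) (expandʳ E (+ x) (+ K) b))
                            (𝟙∣-+ K (E * + x + b) (∣n⇒∣m*n E ∣-refl)))

≡-if-∣-difference : ∀ m x y → x < m → y < m → (+ m) ∣ + x - + y → x ≡ y
≡-if-∣-difference m x y x<m y<m m∣x-y with ∣ + x - + y ∣ in eq
... | zero  = ℤ.+-injective (ℤ.i-j≡0⇒i≡j (+ x) (+ y) (ℤ.∣i∣≡0⇒i≡0 eq))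
... | suc δ = ⊥-elim (ℕ.>⇒∤ δ<m (subst (m ℕ.∣_) eq (∣⇒∣ᵤ m∣x-y)))
  where
  δ<m : suc δ < m
  δ<m = subst (_< m) (trans (cong ∣_∣ (sym (ℤ.[+m]-[+n]≡m⊖n x y))) eq)
              (ℕ.≤-<-trans (ℤ.∣m⊝n∣≤m⊔n x y) (ℕ.⊔-lub x<m y<m))

*-pos-+ : ∀ e x y → e * + (x ℕ.+ y) ≡ e * + x + e * + y
*-pos-+ e x y = trans (cong (e *_) (ℤ.pos-+ x y)) (ℤ.*-distribˡ-+ e (+ x) (+ y))

pos-*-+ : ∀ m t ρ → + (m ℕ.* t ℕ.+ ρ) ≡ + m * + t + + ρ
pos-*-+ m t ρ = trans (ℤ.pos-+ (m ℕ.* t) ρ) (cong (_+ + ρ) (ℤ.pos-* m t))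

Σᶻ : ∀ r → (Fin r → ℕ) → ℤ
Σᶻ r v = sumℤ r (λ j → + v j)

sumℤ-cong : ∀ r {f g : Fin r → ℤ} → (∀ i → f i ≡ g i) → sumℤ r f ≡ sumℤ r g
sumℤ-cong zero    eq = refl
sumℤ-cong (suc r) eq = cong₂ _+_ (eq Fin.zero) (sumℤ-cong r (eq ∘ Fin.suc))

sumℤ-distribˡ-* : ∀ r d (f : Fin r → ℤ) → sumℤ r (λ j → d * f j) ≡ d * sumℤ r f
sumℤ-distribˡ-* zero    d f = sym (ℤ.*-zeroʳ d)
sumℤ-distribˡ-* (suc r) d f = trans (cong (_+_ (d * f Fin.zero)) (sumℤ-distribˡ-* r d (f ∘ Fin.suc)))
                                    (sym (ℤ.*-distribˡ-+ d _ _))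

B-suc : ∀ c d r (i j : Fin r) → B c d (suc r) (Fin.suc i) (Fin.suc j) ≡ B c d r i j
B-suc c d r i j with i Fin.≟ j
... | yes refl = refl
... | no _     = refl

B-row : ∀ c d r (v : Fin r → ℕ) i →
        sumℤ r (λ j → B c d r i j * + v j) ≡ (c - d) * + v i + d * Σᶻ r v
B-row c d (suc r) v Fin.zero = begin
  c * + v₀ + sumℤ r (λ j → d * + v (Fin.suc j))  ≡⟨ cong (_+_ (c * + v₀)) (sumℤ-distribˡ-* r d _) ⟩
  c * + v₀ + d * Σᶻ r (v ∘ Fin.suc)              ≡⟨ regroup c d (+ v₀) _ ⟩
  (c - d) * + v₀ + d * Σᶻ (suc r) v              ∎
  where
  open ≡-Reasoning
  v₀ = v Fin.zero
  regroup : ∀ c d x s → c * x + d * s ≡ (c - d) * x + d * (x + s)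
  regroup = solve-∀
B-row c d (suc r) v (Fin.suc i) = begin
  d * + v₀ + sumℤ r (λ j → B c d (suc r) (Fin.suc i) (Fin.suc j) * + v (Fin.suc j))
    ≡⟨ cong (_+_ (d * + v₀)) (trans (sumℤ-cong r λ j → cong (_* + v (Fin.suc j)) (B-suc c d r i j))
                                    (B-row c d r (v ∘ Fin.suc) i)) ⟩
  d * + v₀ + ((c - d) * + v (Fin.suc i) + d * Σᶻ r (v ∘ Fin.suc))
    ≡⟨ regroup c d (+ v₀) (+ v (Fin.suc i)) _ ⟩
  (c - d) * + v (Fin.suc i) + d * Σᶻ (suc r) v
    ∎
  where
  open ≡-Reasoning
  v₀ = v Fin.zero
  regroup : ∀ c d x y s → d * x + ((c - d) * y + d * s) ≡ (c - d) * y + d * (x + s)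
  regroup = solve-∀

module KernelCount (c d : ℤ) (n : ℕ) .{{_ : NonZero n}} where

  a : ℤ
  a = c - d

  g : ℕ
  g = gcdᶻ a n

  m : ℕ
  m = quot n g

  f : ℤ
  f = d * + m

  mg≡n : m ℕ.* g ≡ n
  mg≡n = quot-* n g (gcd[m,n]∣n (∣ a ∣) n)

  n≡gm : n ≡ g ℕ.* m
  n≡gm = trans (sym mg≡n) (ℕ.*-comm m g)

  instance
    g≢0 : NonZero g
    g≢0 = gcd-nonZero (∣ a ∣) n
    m≢0 : NonZero m
    m≢0 = ℕ.≢-nonZero λ m≡0 → ℕ.≢-nonZero⁻¹ n (trans (sym mg≡n) (cong (ℕ._* g) m≡0))

  n∣am : (+ n) ∣ a * + m
  n∣am = Equivalence.from (∣*⇔quot-gcd∣ℤ a n (+ m)) ∣-refl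

  n∣fg : (+ n) ∣ f * + g
  n∣fg = subst ((+ n) ∣_) dn≡fg (∣n⇒∣m*n d ∣-refl)
    where
    dn≡fg : d * + n ≡ f * + g
    dn≡fg = trans (cong (λ k → d * + k) (sym mg≡n))
                  (trans (cong (d *_) (ℤ.pos-* m g)) (sym (ℤ.*-assoc d (+ m) (+ g))))

  C : ℤ → ℕ
  C z = ∑[ j < g ] 𝟙[ n ∣ z + f * + j ]

  C-+ : ∀ z {w} → (+ n) ∣ w → C (z + w) ≡ C z
  C-+ z {w} n∣w = ∑-cong g λ j →
    trans (cong (λ Z → 𝟙[ n ∣ Z ]) (swap-last z w (f * + j))) (𝟙∣-+ n (z + f * + j) n∣w)
    where
    swap-last : ∀ z w x → z + w + x ≡ z + x + w
    swap-last = solve-∀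

  C-shift : ∀ z t → C (z + f * + t) ≡ C z
  C-shift z t = trans (∑-cong g shifted) (∑-shift g periodic t)
    where
    h : ℕ → ℕ
    h i = 𝟙[ n ∣ z + f * + i ]
    shifted : ∀ j → 𝟙[ n ∣ z + f * + t + f * + j ] ≡ h (t ℕ.+ j)
    shifted j = cong (λ Z → 𝟙[ n ∣ Z ]) (trans (ℤ.+-assoc z _ _) (cong (_+_ z) (sym (*-pos-+ f t j))))
    periodic : Periodic g h
    periodic i = trans (cong (λ Z → 𝟙[ n ∣ z + Z ]) (*-pos-+ f i g))
                       (trans (cong (λ Z → 𝟙[ n ∣ Z ]) (sym (ℤ.+-assoc z _ _))) (𝟙∣-+ n (z + f * + i) n∣fg))

  N : ℤ → ℕ
  N e = ∑[ ρ < m ] C (e * + ρ)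

  InClass : ℕ → ∀ {k} → (Fin k → ℕ) → Set
  InClass ρ w = ∀ i → w i ℕ.% m ≡ ρ

  inClass? : ∀ ρ {k} (w : Fin k → ℕ) → Dec (InClass ρ w)
  inClass? ρ w = all? (λ i → w i ℕ.% m ℕ.≟ ρ)

  IsKernelℕ : ∀ r → (Fin r → ℕ) → Set
  IsKernelℕ r v = ∀ i → n ℕ.∣ ∣ sumℤ r (λ j → B c d r i j * + v j) ∣

  isKernelℕ? : ∀ r (v : Fin r → ℕ) → Dec (IsKernelℕ r v)
  isKernelℕ? r v = all? λ i → n ℕ.∣? ∣ sumℤ r (λ j → B c d r i j * + v j) ∣

  -- For x : Vector (Fin n) r, 𝟙ker r (toℕ ∘ x) is definitionally 𝟙 (isKernel? c d r n x).
  𝟙ker : ∀ r → (Fin r → ℕ) → ℕ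
  𝟙ker r v = 𝟙 (isKernelℕ? r v)

  𝟙ker-ext : ∀ r → Extensional (𝟙ker r)
  𝟙ker-ext r {v} {w} v≗w = 𝟙-cong (isKernelℕ? r v) (isKernelℕ? r w)
    (λ ker i → subst (n ℕ.∣_) (row≡ i) (ker i)) (λ ker i → subst (n ℕ.∣_) (sym (row≡ i)) (ker i))
    where
    row≡ : ∀ i → ∣ sumℤ r (λ j → B c d r i j * + v j) ∣ ≡ ∣ sumℤ r (λ j → B c d r i j * + w j) ∣
    row≡ i = cong ∣_∣ (sumℤ-cong r λ j → cong (λ x → B c d r i j * + x) (v≗w j))

  a*-mod : ∀ y s → ((+ n) ∣ a * + y + s) ⇔ ((+ n) ∣ a * + (y ℕ.% m) + s)
  a*-mod y s = mk⇔ (λ n∣ → ∣m+n∣n⇒∣m (subst ((+ n) ∣_) split n∣) n∣amq)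
                   (λ n∣ → subst ((+ n) ∣_) (sym split) (∣m∣n⇒∣m+n n∣ n∣amq))
    where
    n∣amq : (+ n) ∣ a * + m * + (y ℕ./ m)
    n∣amq = ∣m⇒∣m*n _ n∣am
    expand : ∀ a r q m s → a * (r + q * m) + s ≡ a * r + s + a * m * q
    expand = solve-∀
    y≡r+qm : + y ≡ + (y ℕ.% m) + + (y ℕ./ m) * + m
    y≡r+qm = trans (cong +_ (ℕ.m≡m%n+[m/n]*n y m))
                   (trans (ℤ.pos-+ (y ℕ.% m) _) (cong (_+_ (+ (y ℕ.% m))) (ℤ.pos-* (y ℕ./ m) m)))
    split : a * + y + s ≡ a * + (y ℕ.% m) + s + a * + m * + (y ℕ./ m)
    split = trans (cong (λ x → a * x + s) y≡r+qm) (expand a (+ (y ℕ.% m)) (+ (y ℕ./ m)) (+ m) s)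

  -- Subtracting row 0 from row i leaves n ∣ a (vᵢ − v₀), i.e. m ∣ vᵢ − v₀.
  kernel⇔ : ∀ k (v : Fin (suc k) → ℕ) → let ρ₀ = v Fin.zero ℕ.% m; S = d * Σᶻ (suc k) v in
    IsKernelℕ (suc k) v ⇔ (InClass ρ₀ v × n ℕ.∣ ∣ a * + ρ₀ + S ∣)
  kernel⇔ k v = mk⇔ to from
    where
    ρ : Fin (suc k) → ℕ
    ρ i = v i ℕ.% m
    S = d * Σᶻ (suc k) v
    row-mod : ∀ i → (n ℕ.∣ ∣ sumℤ (suc k) (λ j → B c d (suc k) i j * + v j) ∣) ⇔ ((+ n) ∣ a * + ρ i + S)
    row-mod i = mk⇔
      (λ n∣row → Equivalence.to (a*-mod (v i) S)
                   (subst ((+ n) ∣_) (B-row c d (suc k) v i) (∣ᵤ⇒∣ n∣row)))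
      (λ n∣aρ+S → ∣⇒∣ᵤ (subst ((+ n) ∣_) (sym (B-row c d (suc k) v i))
                   (Equivalence.from (a*-mod (v i) S) n∣aρ+S)))
    difference : ∀ a x y S → a * x + S - (a * y + S) ≡ a * (x - y)
    difference = solve-∀
    same-class : IsKernelℕ (suc k) v → ∀ i → ρ i ≡ ρ Fin.zero
    same-class ker i = ≡-if-∣-difference m (ρ i) (ρ Fin.zero) (ℕ.m%n<n (v i) m) (ℕ.m%n<n (v Fin.zero) m)
      (Equivalence.to (∣*⇔quot-gcd∣ℤ a n (+ ρ i - + ρ Fin.zero))
        (subst ((+ n) ∣_) (difference a (+ ρ i) (+ ρ Fin.zero) S)
          (∣m∣n⇒∣m-n (Equivalence.to (row-mod i) (ker i)) (Equivalence.to (row-mod Fin.zero) (ker Fin.zero)))))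
    to : IsKernelℕ (suc k) v → InClass (ρ Fin.zero) v × n ℕ.∣ ∣ a * + ρ Fin.zero + S ∣
    to ker = same-class ker , ∣⇒∣ᵤ (Equivalence.to (row-mod Fin.zero) (ker Fin.zero))
    from : InClass (ρ Fin.zero) v × n ℕ.∣ ∣ a * + ρ Fin.zero + S ∣ → IsKernelℕ (suc k) v
    from (same , n∣aρ₀+S) i = Equivalence.from (row-mod i)
      (subst (λ r → (+ n) ∣ a * + r + S) (sym (same i)) (∣ᵤ⇒∣ n∣aρ₀+S))

  𝟙ker-classes : ∀ k (v : Fin (suc k) → ℕ) →
    𝟙ker (suc k) v ≡ ∑[ ρ < m ] (𝟙 (inClass? ρ v) ℕ.* 𝟙[ n ∣ a * + ρ + d * Σᶻ (suc k) v ])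
  𝟙ker-classes k v = begin
    𝟙ker (suc k) v
      ≡⟨ 𝟙-cong (isKernelℕ? (suc k) v) (inClass? ρ₀ v ×-dec n∣aρ₀+S?)
                (Equivalence.to (kernel⇔ k v)) (Equivalence.from (kernel⇔ k v)) ⟩
    𝟙 (inClass? ρ₀ v ×-dec n∣aρ₀+S?)
      ≡⟨ 𝟙-× (inClass? ρ₀ v) n∣aρ₀+S? ⟩
    term ρ₀
      ≡⟨ ∑-delta m ρ₀ term (ℕ.m%n<n (v Fin.zero) m) other-classes ⟨
    ∑[ ρ < m ] term ρ
      ∎
    where
    open ≡-Reasoning
    ρ₀ = v Fin.zero ℕ.% m
    S = d * Σᶻ (suc k) v
    n∣aρ₀+S? = n ℕ.∣? ∣ a * + ρ₀ + S ∣
    term : ℕ → ℕ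
    term ρ = 𝟙 (inClass? ρ v) ℕ.* 𝟙[ n ∣ a * + ρ + S ]
    other-classes : ∀ ρ → ρ < m → ρ ≢ ρ₀ → term ρ ≡ 0
    other-classes ρ _ ρ≢ρ₀ =
      cong (ℕ._* 𝟙[ n ∣ a * + ρ + S ]) (𝟙-no (inClass? ρ v) λ cls → ρ≢ρ₀ (sym (cls Fin.zero)))

  Ψ : ℕ → ℕ → ℤ → ℕ
  Ψ k ρ u = ∑ⱽ n k (λ w → 𝟙 (inClass? ρ w) ℕ.* 𝟙[ n ∣ u + d * Σᶻ k w ])

  Ψ-zero : ∀ ρ u → Ψ 0 ρ u ≡ 𝟙[ n ∣ u ]
  Ψ-zero ρ u = trans (ℕ.+-identityʳ _)
    (cong (λ Z → 𝟙[ n ∣ Z ]) (trans (cong (_+_ u) (ℤ.*-zeroʳ d)) (ℤ.+-identityʳ u)))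

  Ψ-suc : ∀ k ρ u → ρ < m → Ψ (suc k) ρ u ≡ ∑[ t < g ] Ψ k ρ (u + d * + (m ℕ.* t ℕ.+ ρ))
  Ψ-suc k ρ u ρ<m = begin
    Ψ (suc k) ρ u
      ≡⟨ ∑-cong n (λ y → trans (∑ⱽ-cong n k (peel y)) (∑ⱽ-distribˡ-* n k (𝟙 (y ℕ.% m ℕ.≟ ρ)) _)) ⟩
    ∑[ y < n ] (𝟙 (y ℕ.% m ℕ.≟ ρ) ℕ.* Ψ k ρ (u + d * + y))
      ≡⟨ cong (λ K → ∑[ y < K ] (𝟙 (y ℕ.% m ℕ.≟ ρ) ℕ.* Ψ k ρ (u + d * + y))) n≡gm ⟩
    ∑[ y < g ℕ.* m ] (𝟙 (y ℕ.% m ℕ.≟ ρ) ℕ.* Ψ k ρ (u + d * + y))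
      ≡⟨ ∑-residue-class g m ρ _ ρ<m ⟩
    ∑[ t < g ] Ψ k ρ (u + d * + (m ℕ.* t ℕ.+ ρ))
      ∎
    where
    open ≡-Reasoning
    inClass-∷ : ∀ y (w : Fin k → ℕ) → 𝟙 (inClass? ρ (y ∷ w)) ≡ 𝟙 (y ℕ.% m ℕ.≟ ρ) ℕ.* 𝟙 (inClass? ρ w)
    inClass-∷ y w = trans (𝟙-cong (inClass? ρ (y ∷ w)) ((y ℕ.% m ℕ.≟ ρ) ×-dec inClass? ρ w)
                            (λ cls → cls Fin.zero , cls ∘ Fin.suc)
                            (λ { (y≡ρ , cls) Fin.zero → y≡ρ ; (y≡ρ , cls) (Fin.suc i) → cls i }))
                          (𝟙-× (y ℕ.% m ℕ.≟ ρ) (inClass? ρ w))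
    distrib : ∀ u d y s → u + d * (y + s) ≡ u + d * y + d * s
    distrib = solve-∀
    peel : ∀ y (w : Fin k → ℕ) →
      𝟙 (inClass? ρ (y ∷ w)) ℕ.* 𝟙[ n ∣ u + d * Σᶻ (suc k) (y ∷ w) ] ≡
      𝟙 (y ℕ.% m ℕ.≟ ρ) ℕ.* (𝟙 (inClass? ρ w) ℕ.* 𝟙[ n ∣ u + d * + y + d * Σᶻ k w ])
    peel y w = trans (cong₂ ℕ._*_ (inClass-∷ y w) (cong (λ Z → 𝟙[ n ∣ Z ]) (distrib u d (+ y) (Σᶻ k w))))
                     (ℕ.*-assoc (𝟙 (y ℕ.% m ℕ.≟ ρ)) _ _)

  -- Every further coordinate ρ + m t contributes the shift f t, which C absorbs.
  Ψ-closed : ∀ k ρ u → ρ < m → Ψ (suc k) ρ u ≡ g ℕ.^ k ℕ.* C (u + + suc k * (d * + ρ))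
  Ψ-closed zero ρ u ρ<m = begin
    Ψ 1 ρ u
      ≡⟨ Ψ-suc 0 ρ u ρ<m ⟩
    ∑[ t < g ] Ψ 0 ρ (u + d * + (m ℕ.* t ℕ.+ ρ))
      ≡⟨ ∑-cong g (λ t → trans (Ψ-zero ρ (u + d * + (m ℕ.* t ℕ.+ ρ)))
                                (cong (λ Z → 𝟙[ n ∣ Z ]) (regroup t))) ⟩
    C (u + + 1 * (d * + ρ))
      ≡⟨ ℕ.*-identityˡ _ ⟨
    1 ℕ.* C (u + + 1 * (d * + ρ))
      ∎
    where
    open ≡-Reasoning
    rearrange : ∀ u d m t ρ → u + d * (m * t + ρ) ≡ u + + 1 * (d * ρ) + d * m * t
    rearrange = solve-∀
    regroup : ∀ t → u + d * + (m ℕ.* t ℕ.+ ρ) ≡ u + + 1 * (d * + ρ) + f * + t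
    regroup t = trans (cong (λ x → u + d * x) (pos-*-+ m t ρ)) (rearrange u d (+ m) (+ t) (+ ρ))
  Ψ-closed (suc k) ρ u ρ<m = begin
    Ψ (suc (suc k)) ρ u
      ≡⟨ Ψ-suc (suc k) ρ u ρ<m ⟩
    ∑[ t < g ] Ψ (suc k) ρ (u + d * + (m ℕ.* t ℕ.+ ρ))
      ≡⟨ ∑-cong g (λ t → trans (Ψ-closed k ρ (u + d * + (m ℕ.* t ℕ.+ ρ)) ρ<m)
                                (cong (g ℕ.^ k ℕ.*_) (C-regroup t))) ⟩
    ∑[ t < g ] (g ℕ.^ k ℕ.* C z)
      ≡⟨ ∑-const g (g ℕ.^ k ℕ.* C z) ⟩
    g ℕ.* (g ℕ.^ k ℕ.* C z)
      ≡⟨ ℕ.*-assoc g (g ℕ.^ k) (C z) ⟨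
    g ℕ.^ suc k ℕ.* C z
      ∎
    where
    open ≡-Reasoning
    z = u + + suc (suc k) * (d * + ρ)
    rearrange : ∀ u d m t ρ K → u + d * (m * t + ρ) + K * (d * ρ) ≡ u + (+ 1 + K) * (d * ρ) + d * m * t
    rearrange = solve-∀
    C-regroup : ∀ t → C (u + d * + (m ℕ.* t ℕ.+ ρ) + + suc k * (d * + ρ)) ≡ C z
    C-regroup t = trans (cong (λ x → C (u + d * x + + suc k * (d * + ρ))) (pos-*-+ m t ρ))
                        (trans (cong C (rearrange u d (+ m) (+ t) (+ ρ) (+ suc k))) (C-shift z t))

  count-kernel : ∀ k → ∑ⱽ n (suc k) (𝟙ker (suc k)) ≡ g ℕ.^ k ℕ.* N (c + + k * d)
  count-kernel k = begin
    ∑ⱽ n (suc k) (𝟙ker (suc k))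
      ≡⟨ ∑ⱽ-cong n (suc k) (𝟙ker-classes k) ⟩
    ∑ⱽ n (suc k) (λ v → ∑[ ρ < m ] (𝟙 (inClass? ρ v) ℕ.* 𝟙[ n ∣ a * + ρ + d * Σᶻ (suc k) v ]))
      ≡⟨ ∑ⱽ-∑-swap n (suc k) m (λ v ρ → 𝟙 (inClass? ρ v) ℕ.* 𝟙[ n ∣ a * + ρ + d * Σᶻ (suc k) v ]) ⟩
    ∑[ ρ < m ] Ψ (suc k) ρ (a * + ρ)
      ≡⟨ ∑-cong-< m (λ ρ ρ<m → trans (Ψ-closed k ρ (a * + ρ) ρ<m)
                                     (cong (λ Z → g ℕ.^ k ℕ.* C Z) (merge c d (+ k) (+ ρ)))) ⟩
    ∑[ ρ < m ] (g ℕ.^ k ℕ.* C ((c + + k * d) * + ρ))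
      ≡⟨ ∑-distribˡ-* m (g ℕ.^ k) (λ ρ → C ((c + + k * d) * + ρ)) ⟩
    g ℕ.^ k ℕ.* N (c + + k * d)
      ∎
    where
    open ≡-Reasoning
    merge : ∀ c d K ρ → (c - d) * ρ + (+ 1 + K) * (d * ρ) ≡ (c + K * d) * ρ
    merge = solve-∀

  pairs : ℤ → ℕ
  pairs e = ∑[ x < n ] ∑[ y < n ] 𝟙[ n ∣ e * + x + f * + y ]

  C-class : ∀ k t ρ → C ((c + + k * d) * + (m ℕ.* t ℕ.+ ρ)) ≡ C ((c + + k * d) * + ρ)
  C-class k t ρ = begin
    C (e * + (m ℕ.* t ℕ.+ ρ))
      ≡⟨ cong C (trans (cong (e *_) (pos-*-+ m t ρ)) (split c d (+ k) (+ m) (+ t) (+ ρ))) ⟩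
    C (e * + ρ + f * ((+ 1 + + k) * + t) + a * + m * + t)
      ≡⟨ C-+ (e * + ρ + f * ((+ 1 + + k) * + t)) (∣m⇒∣m*n (+ t) n∣am) ⟩
    C (e * + ρ + f * ((+ 1 + + k) * + t))
      ≡⟨ cong (λ Z → C (e * + ρ + f * Z)) (ℤ.pos-* (suc k) t) ⟨
    C (e * + ρ + f * + (suc k ℕ.* t))
      ≡⟨ C-shift (e * + ρ) (suc k ℕ.* t) ⟩
    C (e * + ρ)
      ∎
    where
    open ≡-Reasoning
    e = c + + k * d
    split : ∀ c d K M T R →
            (c + K * d) * (M * T + R) ≡ (c + K * d) * R + d * M * ((+ 1 + K) * T) + (c - d) * M * T
    split = solve-∀

  pairs≡n*N : ∀ k → pairs (c + + k * d) ≡ n ℕ.* N (c + + k * d)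
  pairs≡n*N k = begin
    pairs e                                                ≡⟨ ∑-cong n columns ⟩
    ∑[ x < n ] (m ℕ.* C (e * + x))                         ≡⟨ ∑-distribˡ-* n m _ ⟩
    m ℕ.* ∑[ x < n ] C (e * + x)                           ≡⟨ cong (λ K → m ℕ.* ∑[ x < K ] C (e * + x)) n≡gm ⟩
    m ℕ.* ∑[ x < g ℕ.* m ] C (e * + x)                     ≡⟨ cong (m ℕ.*_) (∑-blocks g m _) ⟩
    m ℕ.* ∑[ t < g ] ∑[ ρ < m ] C (e * + (m ℕ.* t ℕ.+ ρ))  ≡⟨ cong (m ℕ.*_) (∑-cong g λ t → ∑-cong m (C-class k t)) ⟩
    m ℕ.* ∑[ t < g ] N e                                   ≡⟨ cong (m ℕ.*_) (∑-const g (N e)) ⟩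
    m ℕ.* (g ℕ.* N e)                                      ≡⟨ ℕ.*-assoc m g (N e) ⟨
    m ℕ.* g ℕ.* N e                                        ≡⟨ cong (ℕ._* N e) mg≡n ⟩
    n ℕ.* N e                                              ∎
    where
    open ≡-Reasoning
    e = c + + k * d
    columns : ∀ x → ∑[ y < n ] 𝟙[ n ∣ e * + x + f * + y ] ≡ m ℕ.* C (e * + x)
    columns x = trans (cong (λ K → ∑[ y < K ] 𝟙[ n ∣ e * + x + f * + y ]) (sym mg≡n))
                      (∑-periodic m g periodic)
      where
      periodic : Periodic g (λ y → 𝟙[ n ∣ e * + x + f * + y ])
      periodic y = trans (cong (λ Z → 𝟙[ n ∣ e * + x + Z ]) (*-pos-+ f y g))
                         (trans (cong (λ Z → 𝟙[ n ∣ Z ]) (sym (ℤ.+-assoc (e * + x) (f * + y) (f * + g))))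
                                (𝟙∣-+ n (e * + x + f * + y) n∣fg))

  pairs≡n*gcd : ∀ e → pairs e ≡ n ℕ.* gcdᶻ f (gcdᶻ e n)
  pairs≡n*gcd e = begin
    pairs e                                          ≡⟨ ∑-swap n n _ ⟩
    ∑[ y < n ] ∑[ x < n ] 𝟙[ n ∣ e * + x + f * + y ] ≡⟨ ∑-cong n (λ y → ∑-𝟙∣-linear e (f * + y) n) ⟩
    ∑[ y < n ] (h ℕ.* 𝟙[ h ∣ f * + y ])              ≡⟨ ∑-distribˡ-* n h _ ⟩
    h ℕ.* ∑[ y < n ] 𝟙[ h ∣ f * + y ]                ≡⟨ cong (λ K → h ℕ.* ∑[ y < K ] 𝟙[ h ∣ f * + y ]) (sym qh≡n) ⟩
    h ℕ.* ∑[ y < q ℕ.* h ] 𝟙[ h ∣ f * + y ]          ≡⟨ cong (h ℕ.*_) (∑-periodic q h periodic) ⟩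
    h ℕ.* (q ℕ.* ∑[ y < h ] 𝟙[ h ∣ f * + y ])        ≡⟨ cong (λ z → h ℕ.* (q ℕ.* z)) (∑-𝟙∣-homogeneous f h) ⟩
    h ℕ.* (q ℕ.* gcdᶻ f h)                           ≡⟨ ℕ.*-assoc h q _ ⟨
    h ℕ.* q ℕ.* gcdᶻ f h                             ≡⟨ cong (ℕ._* gcdᶻ f h) (trans (ℕ.*-comm h q) qh≡n) ⟩
    n ℕ.* gcdᶻ f h                                   ∎
    where
    open ≡-Reasoning
    h = gcdᶻ e n
    q = quot n h
    instance
      h≢0 : NonZero h
      h≢0 = gcd-nonZero (∣ e ∣) n
    qh≡n : q ℕ.* h ≡ n
    qh≡n = quot-* n h (gcd[m,n]∣n (∣ e ∣) n)
    periodic : Periodic h (λ y → 𝟙[ h ∣ f * + y ])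
    periodic y = trans (cong (λ Z → 𝟙[ h ∣ Z ]) (*-pos-+ f y h)) (𝟙∣-+ h (f * + y) (∣n⇒∣m*n f ∣-refl))

  N-closed : ∀ k → N (c + + k * d) ≡ gcd (gcdᶻ (c + + k * d) n) (∣ d ∣ ℕ.* m)
  N-closed k = begin
    N e                           ≡⟨ ℕ.*-cancelˡ-≡ (N e) _ n (trans (sym (pairs≡n*N k)) (pairs≡n*gcd e)) ⟩
    gcd (∣ f ∣) (gcdᶻ e n)         ≡⟨ cong (λ x → gcd x (gcdᶻ e n)) (ℤ.abs-* d (+ m)) ⟩
    gcd (∣ d ∣ ℕ.* m) (gcdᶻ e n)   ≡⟨ gcd-comm (∣ d ∣ ℕ.* m) (gcdᶻ e n) ⟩
    gcd (gcdᶻ e n) (∣ d ∣ ℕ.* m)   ∎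
    where
    open ≡-Reasoning
    e = c + + k * d

theorem4p7 : (r n : ℕ) → r ≥ 1 → n ≥ 1 → (c d : ℤ) →
    Scochar c d r n ≡ rhs c d r n
theorem4p7 (suc k) n@(suc _) _ _ c d = begin
  Scochar c d (suc k) n
    ≡⟨ length-filter-allVecs n (suc k) (isKernel? c d (suc k) n) (𝟙ker (suc k)) (𝟙ker-ext (suc k)) (λ _ → refl) ⟩
  ∑ⱽ n (suc k) (𝟙ker (suc k))
    ≡⟨ count-kernel k ⟩
  g ℕ.^ k ℕ.* N (c + + k * d)
    ≡⟨ cong (g ℕ.^ k ℕ.*_) (N-closed k) ⟩
  rhs c d (suc k) n
    ∎
  where
  open ≡-Reasoning
  open KernelCount c d n
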